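{- Define polynomials $Q_h(a,b;q,t)$ for $h\ge1$ by $Q_1(a,b;q,t)=1-abt$, $Q_2(a,b;q,t)=1-at-bqt$, and for $h\geq3$, $Q_h(a,b;q,t)=Q_{h-1}(a,1;q,t)-bq^{h-1}t\,Q_{h-2}(a,1;q,t)$. Then for all $h\geq1$, $$ Q_h(a,b;q,t)=\sum_{m=0}^\infty(-t)^m q^{m(m-1)}\left((1-b)\binom{h-m}{m}_q+b\binom{h+1-m}{m}_q-(1-a)(1-b)\binom{h-1-m}{m-1}_q-(1-a)b\binom{h-m}{m-1}_q\right). $$
   Context: The $q$-binomial coefficient is $\binom{n}{k}_q=\frac{(q;q)_n}{(q;q)_k(q;q)_{n-k}}$ for $n\ge0$, $0\le k\le n$, where $(x;q)_n=\prod_{i=0}^{n-1}(1-xq^i)$; for all other integers $n,k$ (in particular $k<0$ or $k>n$) one sets $\binom{n}{k}_q=0$. The sum over $m$ is therefore finite. -}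

module Defs where

open import Algebra.Bundles using (CommutativeRing)
open import Data.Nat as ℕ using (ℕ; zero; suc; _∸_)
open import Data.Integer as ℤ using (ℤ; +_; -[1+_])

-- All objects are polynomials with integer coefficients in a, b, q, t; an
-- identity in ℤ[a,b,q,t] is stated as holding for all elements of every
-- commutative ring.
module QDefs {c ℓ} (R : CommutativeRing c ℓ) where
  open CommutativeRing R

  pow : Carrier → ℕ → Carrier
  pow x zero = 1#
  pow x (suc n) = x * pow x n

  qbinℕ : Carrier → ℕ → ℕ → Carrier
  qbinℕ q n zero = 1#
  qbinℕ q zero (suc k) = 0#
  qbinℕ q (suc n) (suc k) = qbinℕ q n k + pow q (suc k) * qbinℕ q n (suc k)

  -- extended by zero to integer arguments (negative n or negative k give 0;
  -- k > n gives 0 automatically)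
  qbin : Carrier → ℤ → ℤ → Carrier
  qbin q (+ n) (+ k) = qbinℕ q n k
  qbin q (+ n) -[1+ k ] = 0#
  qbin q -[1+ n ] k = 0#

  -- Q h a b q t ; Q 0 is a dummy value (the statement only concerns h ≥ 1)
  Q : ℕ → Carrier → Carrier → Carrier → Carrier → Carrier
  Q zero a b q t = 0#
  Q (suc zero) a b q t = 1# - a * b * t
  Q (suc (suc zero)) a b q t = (1# - a * t) - b * q * t
  Q (suc (suc (suc n))) a b q t =
    Q (suc (suc n)) a 1# q t - b * pow q (suc (suc n)) * t * Q (suc n) a 1# q t

  sumTo : ℕ → (ℕ → Carrier) → Carrier
  sumTo zero f = 0#
  sumTo (suc n) f = sumTo n f + f n

  term : ℕ → Carrier → Carrier → Carrier → Carrier → ℕ → Carrier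
  term h a b q t m =
    pow (- t) m * pow q (m ℕ.* (m ∸ 1)) *
      ( (((1# - b) * qbin q (+ h ℤ.- + m) (+ m)
         + b * qbin q (+ suc h ℤ.- + m) (+ m))
         - (1# - a) * (1# - b) * qbin q (+ h ℤ.- + 1 ℤ.- + m) (+ m ℤ.- + 1))
         - (1# - a) * b * qbin q (+ h ℤ.- + m) (+ m ℤ.- + 1) )

  -- the (finite) sum over m ≥ 0; all terms with m ≥ h + 2 vanish
  RHS : ℕ → Carrier → Carrier → Carrier → Carrier → Carrier
  RHS h a b q t = sumTo (suc (suc h)) (term h a b q t)

-- Let F_h be the right-hand side at b = 0. Pulling out the factor 1 − a, F_h = Φ_h(t) − (1 − a) Ψ_h(t),
-- where Φ_h(t) = Σ_m (−t)^m q^{m(m−1)} [h−m, m]_q is a q-Fibonacci polynomial and, after the shift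
-- m ↦ m + 1, Ψ_{h+2}(t) = −t Φ_h(q²t). The second q-Pascal rule [n+1, k+1] = [n, k+1] + q^{n−k} [n, k]
-- gives Φ_{h+2} = Φ_{h+1} − t q^h Φ_h summand by summand, hence F_{h+3} = F_{h+2} − t q^{h+1} F_{h+1},
-- with F_1 = 1 and F_2 = 1 − at. These are the initial values and the recurrence of Q_h(a, 1) = F_{h+1}.
-- Finally both sides are affine in b: Q_h(a, b) = Q_{h−1}(a, 1) − b q^{h−1} t Q_{h−2}(a, 1) and the
-- right-hand side both equal (1 − b) F_h + b F_{h+1}.
module Submission where

open import Defs
open import Algebra.Bundles using (CommutativeRing)
open import Data.Integer as ℤ using (ℤ; +_; -[1+_]; _⊖_; 0ℤ; 1ℤ)
import Data.Integer.Properties as ℤ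
open import Data.Maybe using (map)
open import Data.Nat as ℕ using (ℕ; zero; suc; _≤_)
import Data.Nat.Properties as ℕ
open import Data.Nat.Tactic.RingSolver using (solve-∀)
open import Data.Product using (_,_)
open import Data.Sign as Sign using (Sign)
open import Function using (_∘_)
open import Relation.Binary.Consequences using (dec⇒weaklyDec)
open import Relation.Binary.PropositionalEquality as ≡ using (_≡_)
open import Relation.Nullary using (yes; no)

module ℤ-CoefficientSolver {c ℓ} (R : CommutativeRing c ℓ) where
  open CommutativeRing R hiding (zero)
  -- The optimised _×_ has 1 × x = x definitionally, so the solver's constant 1ℤ evaluates to 1# itself.
  open import Algebra.Properties.Semiring.Mult.TCOptimised semiring using (_×_; 1+×; ×-homo-+; ×1-homo-*)
  open import Algebra.Properties.Ring ring using (-1*x≈-x)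
  open import Algebra.Properties.Group +-group using (ε⁻¹≈ε; ⁻¹-involutive)
  open import Algebra.Properties.AbelianGroup +-abelianGroup using (⁻¹-∙-comm)
  open import Algebra.Properties.CommutativeSemigroup +-commutativeSemigroup using (interchange)
  open import Algebra.Properties.CommutativeSemigroup *-commutativeSemigroup using ()
    renaming (interchange to *-interchange)
  open import Algebra.Solver.Ring.AlmostCommutativeRing
    using (fromCommutativeRing; _-Raw-AlmostCommutative⟶_)
  open import Relation.Binary.Reasoning.Setoid setoid

  fromℤ : ℤ → Carrier
  fromℤ (+ n) = n × 1#
  fromℤ -[1+ n ] = - (suc n × 1#)

  private
    ⊖-homo : ∀ m n → fromℤ (m ⊖ n) ≈ m × 1# - n × 1#
    ⊖-homo m zero = sym (trans (+-congˡ ε⁻¹≈ε) (+-identityʳ _))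
    ⊖-homo zero (suc n) = sym (+-identityˡ _)
    ⊖-homo (suc m) (suc n) = begin
      fromℤ (suc m ⊖ suc n)             ≡⟨ ≡.cong fromℤ (ℤ.[1+m]⊖[1+n]≡m⊖n m n) ⟩
      fromℤ (m ⊖ n)                     ≈⟨ ⊖-homo m n ⟩
      m × 1# - n × 1#                   ≈⟨ +-identityˡ _ ⟨
      0# + (m × 1# - n × 1#)            ≈⟨ +-congʳ (-‿inverseʳ 1#) ⟨
      (1# - 1#) + (m × 1# - n × 1#)     ≈⟨ interchange 1# (- 1#) (m × 1#) (- (n × 1#)) ⟩
      (1# + m × 1#) + (- 1# - n × 1#)   ≈⟨ +-congˡ (⁻¹-∙-comm 1# (n × 1#)) ⟩
      (1# + m × 1#) - (1# + n × 1#)     ≈⟨ +-cong (1+× m 1#) (-‿cong (1+× n 1#)) ⟨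
      suc m × 1# - suc n × 1#           ∎

    +-homo : ∀ i j → fromℤ (i ℤ.+ j) ≈ fromℤ i + fromℤ j
    +-homo -[1+ m ] -[1+ n ] = begin
      - (suc (suc (m ℕ.+ n)) × 1#)      ≡⟨ ≡.cong (λ k → - (k × 1#)) (ℕ.+-suc (suc m) n) ⟨
      - ((suc m ℕ.+ suc n) × 1#)        ≈⟨ -‿cong (×-homo-+ 1# (suc m) (suc n)) ⟩
      - (suc m × 1# + suc n × 1#)       ≈⟨ ⁻¹-∙-comm _ _ ⟨
      - (suc m × 1#) + - (suc n × 1#)   ∎
    +-homo -[1+ m ] (+ n) = trans (⊖-homo n (suc m)) (+-comm _ _)
    +-homo (+ m) -[1+ n ] = ⊖-homo m (suc n)
    +-homo (+ m) (+ n) = ×-homo-+ 1# m n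

    σ : Sign → Carrier
    σ Sign.+ = 1#
    σ Sign.- = - 1#

    σ-homo : ∀ s r → σ (s Sign.* r) ≈ σ s * σ r
    σ-homo Sign.+ r = sym (*-identityˡ _)
    σ-homo Sign.- Sign.+ = sym (*-identityʳ _)
    σ-homo Sign.- Sign.- = sym (trans (-1*x≈-x (- 1#)) (⁻¹-involutive 1#))

    ◃-homo : ∀ s n → fromℤ (s ℤ.◃ n) ≈ σ s * n × 1#
    ◃-homo s zero = sym (zeroʳ _)
    ◃-homo Sign.+ (suc n) = sym (*-identityˡ _)
    ◃-homo Sign.- (suc n) = sym (-1*x≈-x _)

    fromℤ-sign-abs : ∀ i → fromℤ i ≈ σ (ℤ.sign i) * ℤ.∣ i ∣ × 1#
    fromℤ-sign-abs (+ n) = sym (*-identityˡ _)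
    fromℤ-sign-abs -[1+ n ] = sym (-1*x≈-x _)

    *-homo : ∀ i j → fromℤ (i ℤ.* j) ≈ fromℤ i * fromℤ j
    *-homo i j = begin
      fromℤ ((ℤ.sign i Sign.* ℤ.sign j) ℤ.◃ (ℤ.∣ i ∣ ℕ.* ℤ.∣ j ∣))
        ≈⟨ ◃-homo (ℤ.sign i Sign.* ℤ.sign j) (ℤ.∣ i ∣ ℕ.* ℤ.∣ j ∣) ⟩
      σ (ℤ.sign i Sign.* ℤ.sign j) * (ℤ.∣ i ∣ ℕ.* ℤ.∣ j ∣) × 1#
        ≈⟨ *-cong (σ-homo (ℤ.sign i) (ℤ.sign j)) (×1-homo-* ℤ.∣ i ∣ ℤ.∣ j ∣) ⟩
      (σ (ℤ.sign i) * σ (ℤ.sign j)) * (ℤ.∣ i ∣ × 1# * ℤ.∣ j ∣ × 1#)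
        ≈⟨ *-interchange _ _ _ _ ⟩
      (σ (ℤ.sign i) * ℤ.∣ i ∣ × 1#) * (σ (ℤ.sign j) * ℤ.∣ j ∣ × 1#)
        ≈⟨ *-cong (fromℤ-sign-abs i) (fromℤ-sign-abs j) ⟨
      fromℤ i * fromℤ j ∎

    -‿homo : ∀ i → fromℤ (ℤ.- i) ≈ - fromℤ i
    -‿homo (+ zero) = sym ε⁻¹≈ε
    -‿homo (+ suc n) = refl
    -‿homo -[1+ n ] = sym (⁻¹-involutive _)

  fromℤ-homomorphism : ℤ.+-*-rawRing -Raw-AlmostCommutative⟶ fromCommutativeRing R
  fromℤ-homomorphism = record
    { ⟦_⟧ = fromℤ ; +-homo = +-homo ; *-homo = *-homo ; -‿homo = -‿homo
    ; 0-homo = refl ; 1-homo = refl }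

  open import Algebra.Solver.Ring ℤ.+-*-rawRing (fromCommutativeRing R) fromℤ-homomorphism
    (λ i j → map (reflexive ∘ ≡.cong fromℤ) (dec⇒weaklyDec ℤ._≟_ i j)) public

module SumToProperties {c ℓ} (R : CommutativeRing c ℓ) where
  open CommutativeRing R hiding (zero)
  open QDefs R using (sumTo)
  open ℤ-CoefficientSolver R using (solve; _:+_; _:-_; con; _:=_)
  open import Algebra.Properties.CommutativeSemigroup +-commutativeSemigroup using (interchange)

  sumTo-cong : ∀ n {f g : ℕ → Carrier} → (∀ m → f m ≈ g m) → sumTo n f ≈ sumTo n g
  sumTo-cong zero f≈g = refl
  sumTo-cong (suc n) f≈g = +-cong (sumTo-cong n f≈g) (f≈g n)

  sumTo-unshift : ∀ n (f : ℕ → Carrier) → sumTo (suc n) f ≈ f 0 + sumTo n (f ∘ suc)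
  sumTo-unshift zero f = trans (+-identityˡ _) (sym (+-identityʳ _))
  sumTo-unshift (suc n) f = trans (+-congʳ (sumTo-unshift n f)) (+-assoc _ _ _)

  sumTo-dropLast : ∀ n {f : ℕ → Carrier} → f n ≈ 0# → sumTo (suc n) f ≈ sumTo n f
  sumTo-dropLast n fn≈0 = trans (+-congˡ fn≈0) (+-identityʳ _)

  sumTo-+ : ∀ n (f g : ℕ → Carrier) → sumTo n (λ m → f m + g m) ≈ sumTo n f + sumTo n g
  sumTo-+ zero f g = sym (+-identityˡ 0#)
  sumTo-+ (suc n) f g = trans (+-congʳ (sumTo-+ n f g)) (interchange _ _ _ _)

  sumTo-sub : ∀ n (f g : ℕ → Carrier) → sumTo n (λ m → f m - g m) ≈ sumTo n f - sumTo n g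
  sumTo-sub zero f g = solve 0 (con 0ℤ := con 0ℤ :- con 0ℤ) refl
  sumTo-sub (suc n) f g = trans (+-congʳ (sumTo-sub n f g))
    (solve 4 (λ x y z w → (x :- y) :+ (z :- w) := (x :+ z) :- (y :+ w)) refl _ _ _ _)

  sumTo-*ˡ : ∀ n x (f : ℕ → Carrier) → sumTo n (λ m → x * f m) ≈ x * sumTo n f
  sumTo-*ˡ zero x f = sym (zeroʳ x)
  sumTo-*ˡ (suc n) x f = trans (+-congʳ (sumTo-*ˡ n x f)) (sym (distribˡ x _ _))

  sumTo-linear : ∀ n x y (f g : ℕ → Carrier) →
    sumTo n (λ m → x * f m + y * g m) ≈ x * sumTo n f + y * sumTo n g
  sumTo-linear n x y f g = trans (sumTo-+ n _ _) (+-cong (sumTo-*ˡ n x f) (sumTo-*ˡ n y g))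

module PowProperties {c ℓ} (R : CommutativeRing c ℓ) where
  open CommutativeRing R hiding (zero)
  open QDefs R using (pow)
  open import Algebra.Properties.Semiring.Exp semiring using (_^_; ^-homo-*)
  open import Algebra.Properties.CommutativeSemiring.Exp commutativeSemiring using (^-distrib-*)
  open import Relation.Binary.Reasoning.Setoid setoid

  pow≈^ : ∀ x n → pow x n ≈ x ^ n
  pow≈^ x zero = refl
  pow≈^ x (suc n) = *-congˡ (pow≈^ x n)

  pow-congˡ : ∀ {x y} n → x ≈ y → pow x n ≈ pow y n
  pow-congˡ zero x≈y = refl
  pow-congˡ (suc n) x≈y = *-cong x≈y (pow-congˡ n x≈y)

  pow-+ : ∀ x m n → pow x (m ℕ.+ n) ≈ pow x m * pow x n
  pow-+ x m n = begin
    pow x (m ℕ.+ n)   ≈⟨ pow≈^ x (m ℕ.+ n) ⟩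
    x ^ (m ℕ.+ n)     ≈⟨ ^-homo-* x m n ⟩
    x ^ m * x ^ n     ≈⟨ *-cong (pow≈^ x m) (pow≈^ x n) ⟨
    pow x m * pow x n ∎

  pow-distrib-* : ∀ x y n → pow (x * y) n ≈ pow x n * pow y n
  pow-distrib-* x y n = begin
    pow (x * y) n     ≈⟨ pow≈^ (x * y) n ⟩
    (x * y) ^ n       ≈⟨ ^-distrib-* x y n ⟩
    x ^ n * y ^ n     ≈⟨ *-cong (pow≈^ x n) (pow≈^ y n) ⟨
    pow x n * pow y n ∎

module GaussianBinomialProperties {c ℓ} (R : CommutativeRing c ℓ) (q : CommutativeRing.Carrier R) where
  open CommutativeRing R hiding (zero)
  open QDefs R using (pow; qbinℕ; qbin)
  open ℤ-CoefficientSolver R using (solve; _:+_; _:*_; con; _:=_)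
  open import Relation.Binary.Reasoning.Setoid setoid

  qbinℕ-vanish : ∀ {n k} → n ℕ.< k → qbinℕ q n k ≈ 0#
  qbinℕ-vanish {zero} {suc k} _ = refl
  qbinℕ-vanish {suc n} {suc k} (ℕ.s≤s n<k) = begin
    qbinℕ q n k + pow q (suc k) * qbinℕ q n (suc k)
      ≈⟨ +-cong (qbinℕ-vanish n<k) (*-congˡ (qbinℕ-vanish (ℕ.m<n⇒m<1+n n<k))) ⟩
    0# + pow q (suc k) * 0# ≈⟨ trans (+-identityˡ _) (zeroʳ _) ⟩
    0#                      ∎

  qbinℕ-diag : ∀ n → qbinℕ q n n ≈ 1#
  qbinℕ-diag zero = refl
  qbinℕ-diag (suc n) = begin
    qbinℕ q n n + pow q (suc n) * qbinℕ q n (suc n)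
      ≈⟨ +-cong (qbinℕ-diag n) (*-congˡ (qbinℕ-vanish (ℕ.n<1+n n))) ⟩
    1# + pow q (suc n) * 0# ≈⟨ trans (+-congˡ (zeroʳ _)) (+-identityʳ 1#) ⟩
    1#                      ∎

  private
    -- gauss k n = [k + n, k]_q. In this symmetric indexing the second q-Pascal rule is the
    -- first one with k and n exchanged.
    gauss : ℕ → ℕ → Carrier
    gauss k n = qbinℕ q (k ℕ.+ n) k

    gauss-zeroʳ : ∀ k → gauss k 0 ≈ 1#
    gauss-zeroʳ k = trans (reflexive (≡.cong (λ n → qbinℕ q n k) (ℕ.+-identityʳ k))) (qbinℕ-diag k)

    gauss-pascal : ∀ k n → gauss (suc k) (suc n) ≈ gauss k (suc n) + pow q (suc k) * gauss (suc k) n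
    gauss-pascal k n = +-congˡ (*-congˡ (reflexive (≡.cong (λ m → qbinℕ q m (suc k)) (ℕ.+-suc k n))))

    gauss-pascalʳ : ∀ k n → gauss (suc k) (suc n) ≈ gauss (suc k) n + pow q (suc n) * gauss k (suc n)
    gauss-pascalʳ zero zero = begin
      gauss 1 1                 ≈⟨ gauss-pascal 0 0 ⟩
      1# + pow q 1 * gauss 1 0  ≈⟨ +-cong (sym (gauss-zeroʳ 1)) (*-congˡ (gauss-zeroʳ 1)) ⟩
      gauss 1 0 + pow q 1 * 1#  ∎
    gauss-pascalʳ zero (suc n) = begin
      gauss 1 (2 ℕ.+ n)                                  ≈⟨ gauss-pascal 0 (suc n) ⟩
      1# + pow q 1 * gauss 1 (suc n)                     ≈⟨ +-congˡ (*-congˡ (gauss-pascalʳ zero n)) ⟩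
      1# + pow q 1 * (gauss 1 n + pow q (suc n) * 1#)
        ≈⟨ solve 3 (λ x p q → con 1ℤ :+ (q :* con 1ℤ) :* (x :+ (q :* p) :* con 1ℤ)
                           := (con 1ℤ :+ (q :* con 1ℤ) :* x) :+ (q :* (q :* p)) :* con 1ℤ)
                   refl (gauss 1 n) (pow q n) q ⟩
      (1# + pow q 1 * gauss 1 n) + pow q (2 ℕ.+ n) * 1#  ≈⟨ +-congʳ (gauss-pascal 0 n) ⟨
      gauss 1 (suc n) + pow q (2 ℕ.+ n) * 1#             ∎
    gauss-pascalʳ (suc k) zero = begin
      gauss (2 ℕ.+ k) 1
        ≈⟨ gauss-pascal (suc k) 0 ⟩
      gauss (suc k) 1 + pow q (2 ℕ.+ k) * gauss (2 ℕ.+ k) 0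
        ≈⟨ +-cong (gauss-pascalʳ k zero) (*-congˡ (gauss-zeroʳ (2 ℕ.+ k))) ⟩
      (gauss (suc k) 0 + pow q 1 * gauss k 1) + pow q (2 ℕ.+ k) * 1#
        ≈⟨ +-congʳ (+-congʳ (gauss-zeroʳ (suc k))) ⟩
      (1# + pow q 1 * gauss k 1) + pow q (2 ℕ.+ k) * 1#
        ≈⟨ solve 3 (λ x p q → (con 1ℤ :+ (q :* con 1ℤ) :* x) :+ (q :* (q :* p)) :* con 1ℤ
                           := con 1ℤ :+ (q :* con 1ℤ) :* (x :+ (q :* p) :* con 1ℤ))
                   refl (gauss k 1) (pow q k) q ⟩
      1# + pow q 1 * (gauss k 1 + pow q (suc k) * 1#)
        ≈⟨ +-cong (gauss-zeroʳ (2 ℕ.+ k))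
                  (*-congˡ (trans (gauss-pascal k 0) (+-congˡ (*-congˡ (gauss-zeroʳ (suc k)))))) ⟨
      gauss (2 ℕ.+ k) 0 + pow q 1 * gauss (suc k) 1
        ∎
    gauss-pascalʳ (suc k) (suc n) = begin
      gauss (suc K) (suc N)
        ≈⟨ gauss-pascal K N ⟩
      gauss K (suc N) + pow q (suc K) * gauss (suc K) N
        ≈⟨ +-cong (gauss-pascalʳ k (suc n)) (*-congˡ (gauss-pascalʳ (suc k) n)) ⟩
      (gauss K N + pow q (suc N) * gauss k (suc N)) + pow q (suc K) * (gauss (suc K) n + pow q N * gauss K N)
        ≈⟨ solve 6 (λ x y z q qN qK → (x :+ (q :* qN) :* y) :+ (q :* qK) :* (z :+ qN :* x)
                                   := (x :+ (q :* qK) :* z) :+ (q :* qN) :* (y :+ qK :* x))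
                   refl (gauss K N) (gauss k (suc N)) (gauss (suc K) n) q (pow q N) (pow q K) ⟩
      (gauss K N + pow q (suc K) * gauss (suc K) n) + pow q (suc N) * (gauss k (suc N) + pow q K * gauss K N)
        ≈⟨ +-cong (gauss-pascal K n) (*-congˡ (gauss-pascal k N)) ⟨
      gauss (suc K) N + pow q (suc N) * gauss K (suc N)
        ∎
      where
      K = suc k
      N = suc n

  qbinℕ-pascalʳ : ∀ k d →
    qbinℕ q (suc (k ℕ.+ d)) (suc k) ≈ qbinℕ q (k ℕ.+ d) (suc k) + pow q d * qbinℕ q (k ℕ.+ d) k
  qbinℕ-pascalʳ k zero = begin
    qbinℕ q (k ℕ.+ 0) k + pow q (suc k) * qbinℕ q (k ℕ.+ 0) (suc k)  ≈⟨ +-congˡ (*-congˡ k+0<1+k) ⟩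
    qbinℕ q (k ℕ.+ 0) k + pow q (suc k) * 0#
      ≈⟨ solve 2 (λ x p → x :+ p :* con 0ℤ := con 0ℤ :+ con 1ℤ :* x) refl _ _ ⟩
    0# + 1# * qbinℕ q (k ℕ.+ 0) k                                     ≈⟨ +-congʳ k+0<1+k ⟨
    qbinℕ q (k ℕ.+ 0) (suc k) + 1# * qbinℕ q (k ℕ.+ 0) k             ∎
    where
    k+0<1+k = qbinℕ-vanish (ℕ.s≤s (ℕ.≤-reflexive (ℕ.+-identityʳ k)))
  qbinℕ-pascalʳ k (suc n) =
    trans (gauss-pascalʳ k n) (+-congʳ (reflexive (≡.cong (λ m → qbinℕ q m (suc k)) (≡.sym (ℕ.+-suc k n)))))

  qbin-⊖ : ∀ n m {k} → m ℕ.≤ k → qbin q (n ⊖ m) (+ k) ≈ qbinℕ q (n ℕ.∸ m) k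
  qbin-⊖ n zero _ = refl
  qbin-⊖ zero (suc m) {suc k} _ = refl
  qbin-⊖ (suc n) (suc m) {k} m<k = begin
    qbin q (suc n ⊖ suc m) (+ k) ≡⟨ ≡.cong (λ z → qbin q z (+ k)) (ℤ.[1+m]⊖[1+n]≡m⊖n n m) ⟩
    qbin q (n ⊖ m) (+ k)         ≈⟨ qbin-⊖ n m (ℕ.<⇒≤ m<k) ⟩
    qbinℕ q (n ℕ.∸ m) k          ∎

module QFibonacci {c ℓ} (R : CommutativeRing c ℓ) (q : CommutativeRing.Carrier R) where
  open CommutativeRing R hiding (zero)
  open QDefs R
  open ℤ-CoefficientSolver R using (solve; _:+_; _:*_; _:-_; :-_; con; _:=_)
  open SumToProperties R
  open PowProperties R
  open GaussianBinomialProperties R q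
  open import Algebra.Properties.Ring ring using (-‿distribʳ-*)
  open import Relation.Binary.Reasoning.Setoid setoid

  weight : Carrier → ℕ → Carrier
  weight t m = pow (- t) m * pow q (m ℕ.* (m ℕ.∸ 1))

  weight-rescale : ∀ t m → weight (q * q * t) m ≈ pow q (m ℕ.+ m) * weight t m
  weight-rescale t m = begin
    pow (- (q * q * t)) m * pow q (m ℕ.* (m ℕ.∸ 1))
      ≈⟨ *-congʳ (pow-congˡ m (-‿distribʳ-* (q * q) t)) ⟩
    pow (q * q * - t) m * pow q (m ℕ.* (m ℕ.∸ 1))
      ≈⟨ *-congʳ (pow-distrib-* (q * q) (- t) m) ⟩
    (pow (q * q) m * pow (- t) m) * pow q (m ℕ.* (m ℕ.∸ 1))
      ≈⟨ *-congʳ (*-congʳ (trans (pow-distrib-* q q m) (sym (pow-+ q m m)))) ⟩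
    (pow q (m ℕ.+ m) * pow (- t) m) * pow q (m ℕ.* (m ℕ.∸ 1))
      ≈⟨ *-assoc _ _ _ ⟩
    pow q (m ℕ.+ m) * weight t m
      ∎

  weight-suc : ∀ t m → weight t (suc m) ≈ - t * weight (q * q * t) m
  weight-suc t m = begin
    (- t * pow (- t) m) * pow q (suc m ℕ.* m)
      ≈⟨ *-congˡ (trans (reflexive (≡.cong (pow q) (exponent m))) (pow-+ q (m ℕ.+ m) _)) ⟩
    (- t * pow (- t) m) * (pow q (m ℕ.+ m) * pow q (m ℕ.* (m ℕ.∸ 1)))
      ≈⟨ solve 4 (λ t x y z → (:- t :* x) :* (y :* z) := :- t :* (y :* (x :* z))) refl t _ _ _ ⟩
    - t * (pow q (m ℕ.+ m) * weight t m)
      ≈⟨ *-congˡ (weight-rescale t m) ⟨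
    - t * weight (q * q * t) m
      ∎
    where
    exponent : ∀ m → suc m ℕ.* m ≡ m ℕ.+ m ℕ.+ m ℕ.* (m ℕ.∸ 1)
    exponent zero = ≡.refl
    exponent (suc m) = suc-exponent m
      where
      suc-exponent : ∀ m → (2 ℕ.+ m) ℕ.* (1 ℕ.+ m) ≡ (1 ℕ.+ m) ℕ.+ (1 ℕ.+ m) ℕ.+ (1 ℕ.+ m) ℕ.* m
      suc-exponent = solve-∀

  -- [h − m, m]_q; the truncated subtraction is harmless, as this vanishes as soon as h < 2m.
  fibCoeff : ℕ → ℕ → Carrier
  fibCoeff h m = qbinℕ q (h ℕ.∸ m) m

  fibCoeff-vanish : ∀ h m → h ℕ.< m ℕ.+ m → fibCoeff h m ≈ 0#
  fibCoeff-vanish h (suc m) h<2m = qbinℕ-vanish (ℕ.m<n+o⇒m∸n<o h (suc m) h<2m)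

  qbin≈fibCoeff : ∀ h m → qbin q (+ h ℤ.- + m) (+ m) ≈ fibCoeff h m
  qbin≈fibCoeff h m =
    trans (reflexive (≡.cong (λ z → qbin q z (+ m)) (ℤ.m-n≡m⊖n h m))) (qbin-⊖ h m ℕ.≤-refl)

  private
    fibCoeff-step-≥ : ∀ k d → let h = k ℕ.+ k ℕ.+ d in
      pow q (k ℕ.+ k) * fibCoeff (2 ℕ.+ h) (suc k)
        ≈ pow q (k ℕ.+ k) * fibCoeff (suc h) (suc k) + pow q h * fibCoeff h k
    fibCoeff-step-≥ k d = begin
      q^2k * qbinℕ q (suc h ℕ.∸ k) (suc k)
        ≡⟨ ≡.cong (λ n → q^2k * qbinℕ q n (suc k)) (≡.trans (ℕ.+-∸-assoc 1 k≤h) (≡.cong suc h∸k)) ⟩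
      q^2k * qbinℕ q (suc (k ℕ.+ d)) (suc k)
        ≈⟨ *-congˡ (qbinℕ-pascalʳ k d) ⟩
      q^2k * (qbinℕ q (k ℕ.+ d) (suc k) + pow q d * qbinℕ q (k ℕ.+ d) k)
        ≈⟨ solve 4 (λ x y p z → x :* (y :+ p :* z) := x :* y :+ (x :* p) :* z) refl q^2k _ _ _ ⟩
      q^2k * qbinℕ q (k ℕ.+ d) (suc k) + (q^2k * pow q d) * qbinℕ q (k ℕ.+ d) k
        ≈⟨ +-congˡ (*-congʳ (pow-+ q (k ℕ.+ k) d)) ⟨
      q^2k * qbinℕ q (k ℕ.+ d) (suc k) + pow q h * qbinℕ q (k ℕ.+ d) k
        ≡⟨ ≡.cong (λ n → q^2k * qbinℕ q n (suc k) + pow q h * qbinℕ q n k) h∸k ⟨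
      q^2k * fibCoeff (suc h) (suc k) + pow q h * fibCoeff h k
        ∎
      where
      h = k ℕ.+ k ℕ.+ d
      q^2k = pow q (k ℕ.+ k)
      h∸k : h ℕ.∸ k ≡ k ℕ.+ d
      h∸k = ≡.trans (≡.cong (ℕ._∸ k) (ℕ.+-assoc k k d)) (ℕ.m+n∸m≡n k (k ℕ.+ d))
      k≤h : k ℕ.≤ h
      k≤h = ℕ.≤-trans (ℕ.m≤m+n k k) (ℕ.m≤m+n (k ℕ.+ k) d)

  fibCoeff-step : ∀ h k →
    pow q (k ℕ.+ k) * fibCoeff (2 ℕ.+ h) (suc k) ≈ pow q (k ℕ.+ k) * fibCoeff (suc h) (suc k) + pow q h * fibCoeff h k
  fibCoeff-step h k with k ℕ.+ k ℕ.≤? h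
  ... | yes 2k≤h with ℕ.m≤n⇒∃[o]m+o≡n 2k≤h
  ...   | d , ≡.refl = fibCoeff-step-≥ k d
  fibCoeff-step h k | no 2k≰h = begin
    pow q (k ℕ.+ k) * fibCoeff (2 ℕ.+ h) (suc k)
      ≈⟨ *-congˡ (fibCoeff-vanish (2 ℕ.+ h) (suc k) 2+h<2[1+k]) ⟩
    pow q (k ℕ.+ k) * 0#
      ≈⟨ solve 2 (λ x y → x :* con 0ℤ := x :* con 0ℤ :+ y :* con 0ℤ) refl _ _ ⟩
    pow q (k ℕ.+ k) * 0# + pow q h * 0#
      ≈⟨ +-cong (*-congˡ (fibCoeff-vanish (suc h) (suc k) (ℕ.<⇒≤ 2+h<2[1+k])))
                (*-congˡ (fibCoeff-vanish h k h<2k)) ⟨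
    pow q (k ℕ.+ k) * fibCoeff (suc h) (suc k) + pow q h * fibCoeff h k
      ∎
    where
    h<2k = ℕ.≰⇒> 2k≰h
    2+h<2[1+k] : 2 ℕ.+ h ℕ.< suc k ℕ.+ suc k
    2+h<2[1+k] = ℕ.≤-trans (ℕ.s≤s (ℕ.s≤s h<2k)) (ℕ.≤-reflexive (≡.cong suc (≡.sym (ℕ.+-suc k k))))

  fib : Carrier → ℕ → Carrier
  fib t h = sumTo (suc h) (λ m → weight t m * fibCoeff h m)

  fib-zero : ∀ t → fib t 0 ≈ 1#
  fib-zero t = trans (+-identityˡ _) (trans (*-identityʳ _) (*-identityʳ 1#))

  fib-one : ∀ t → fib t 1 ≈ 1#
  fib-one t = trans (+-cong (fib-zero t) (zeroʳ _)) (+-identityʳ 1#)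

  fib-extend : ∀ t h → sumTo (2 ℕ.+ h) (λ m → weight t m * fibCoeff h m) ≈ fib t h
  fib-extend t h = sumTo-dropLast (suc h)
    (trans (*-congˡ (fibCoeff-vanish h (suc h) (ℕ.m≤m+n (suc h) (suc h)))) (zeroʳ _))

  fib-summand-step : ∀ t h k →
    weight t (suc k) * fibCoeff (2 ℕ.+ h) (suc k)
      ≈ weight t (suc k) * fibCoeff (suc h) (suc k) - t * pow q h * (weight t k * fibCoeff h k)
  fib-summand-step t h k = begin
    weight t (suc k) * fibCoeff (2 ℕ.+ h) (suc k)
      ≈⟨ *-congʳ weight-suc′ ⟩
    (- t * (q^2k * weight t k)) * fibCoeff (2 ℕ.+ h) (suc k)
      ≈⟨ solve 4 (λ t x w y → (:- t :* (x :* w)) :* y := :- t :* w :* (x :* y)) refl t q^2k _ _ ⟩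
    - t * weight t k * (q^2k * fibCoeff (2 ℕ.+ h) (suc k))
      ≈⟨ *-congˡ (fibCoeff-step h k) ⟩
    - t * weight t k * (q^2k * fibCoeff (suc h) (suc k) + pow q h * fibCoeff h k)
      ≈⟨ solve 6 (λ t x w y p z → :- t :* w :* (x :* y :+ p :* z) := (:- t :* (x :* w)) :* y :- t :* p :* (w :* z))
                 refl t q^2k _ _ _ _ ⟩
    (- t * (q^2k * weight t k)) * fibCoeff (suc h) (suc k) - t * pow q h * (weight t k * fibCoeff h k)
      ≈⟨ +-congʳ (*-congʳ weight-suc′) ⟨
    weight t (suc k) * fibCoeff (suc h) (suc k) - t * pow q h * (weight t k * fibCoeff h k)
      ∎
    where
    q^2k = pow q (k ℕ.+ k)
    weight-suc′ : weight t (suc k) ≈ - t * (q^2k * weight t k)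
    weight-suc′ = trans (weight-suc t k) (*-congˡ (weight-rescale t k))

  fib-rec : ∀ t h → fib t (2 ℕ.+ h) ≈ fib t (suc h) - t * pow q h * fib t h
  fib-rec t h = begin
    sumTo (3 ℕ.+ h) (summand (2 ℕ.+ h))
      ≈⟨ sumTo-unshift (2 ℕ.+ h) (summand (2 ℕ.+ h)) ⟩
    summand (suc h) 0 + sumTo (2 ℕ.+ h) (summand (2 ℕ.+ h) ∘ suc)
      ≈⟨ +-congˡ (sumTo-cong (2 ℕ.+ h) (fib-summand-step t h)) ⟩
    summand (suc h) 0 + sumTo (2 ℕ.+ h) (λ k → summand (suc h) (suc k) - s * summand h k)
      ≈⟨ +-congˡ (trans (sumTo-sub (2 ℕ.+ h) _ _) (+-congˡ (-‿cong (sumTo-*ˡ (2 ℕ.+ h) s (summand h))))) ⟩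
    summand (suc h) 0 + (sumTo (2 ℕ.+ h) (summand (suc h) ∘ suc) - s * sumTo (2 ℕ.+ h) (summand h))
      ≈⟨ +-assoc _ _ _ ⟨
    (summand (suc h) 0 + sumTo (2 ℕ.+ h) (summand (suc h) ∘ suc)) - s * sumTo (2 ℕ.+ h) (summand h)
      ≈⟨ +-cong (sym (sumTo-unshift (2 ℕ.+ h) (summand (suc h)))) (-‿cong (*-congˡ (fib-extend t h))) ⟩
    sumTo (3 ℕ.+ h) (summand (suc h)) - s * fib t h
      ≈⟨ +-congʳ (fib-extend t (suc h)) ⟩
    fib t (suc h) - s * fib t h
      ∎
    where
    s = t * pow q h
    summand : ℕ → ℕ → Carrier
    summand h m = weight t m * fibCoeff h m

  shiftedCoeff : ℕ → ℕ → Carrier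
  shiftedCoeff h m = qbin q (+ h ℤ.- + 1 ℤ.- + m) (+ m ℤ.- + 1)

  shiftedCoeff-zero : ∀ h → shiftedCoeff h 0 ≈ 0#
  shiftedCoeff-zero h = reflexive (qbin-negative (+ h ℤ.- + 1 ℤ.- + 0))
    where
    qbin-negative : ∀ z → qbin q z -[1+ 0 ] ≡ 0#
    qbin-negative (+ n) = ≡.refl
    qbin-negative -[1+ n ] = ≡.refl

  shiftedCoeff-suc-suc : ∀ h m → shiftedCoeff (2 ℕ.+ h) (suc m) ≈ fibCoeff h m
  shiftedCoeff-suc-suc h m =
    trans (reflexive (≡.cong (λ z → qbin q z (+ m)) (ℤ.[1+m]⊖[1+n]≡m⊖n h m))) (qbin-⊖ h m ℕ.≤-refl)

  shiftedCoeff-vanish : ∀ h → shiftedCoeff h (suc h) ≈ 0#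
  shiftedCoeff-vanish zero = refl
  shiftedCoeff-vanish (suc zero) = refl
  shiftedCoeff-vanish (suc (suc h)) = trans (shiftedCoeff-suc-suc h (2 ℕ.+ h))
    (fibCoeff-vanish h (2 ℕ.+ h) (ℕ.m≤n⇒m≤n+o (2 ℕ.+ h) (ℕ.n≤1+n (suc h))))

  shiftedFib : Carrier → ℕ → Carrier
  shiftedFib t h = sumTo (suc h) (λ m → weight t m * shiftedCoeff h m)

  shiftedFib-extend : ∀ t h → sumTo (2 ℕ.+ h) (λ m → weight t m * shiftedCoeff h m) ≈ shiftedFib t h
  shiftedFib-extend t h = sumTo-dropLast (suc h) (trans (*-congˡ (shiftedCoeff-vanish h)) (zeroʳ _))

  shiftedFib-one : ∀ t → shiftedFib t 1 ≈ 0#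
  shiftedFib-one t =
    solve 2 (λ x y → (con 0ℤ :+ x :* con 0ℤ) :+ y :* con 0ℤ := con 0ℤ) refl (weight t 0) (weight t 1)

  shiftedFib-suc-suc : ∀ t h → shiftedFib t (2 ℕ.+ h) ≈ - t * fib (q * q * t) h
  shiftedFib-suc-suc t h = begin
    shiftedFib t (2 ℕ.+ h)
      ≈⟨ sumTo-unshift (2 ℕ.+ h) _ ⟩
    weight t 0 * shiftedCoeff (2 ℕ.+ h) 0 + sumTo (2 ℕ.+ h) (λ k → weight t (suc k) * shiftedCoeff (2 ℕ.+ h) (suc k))
      ≈⟨ +-cong (trans (*-congˡ (shiftedCoeff-zero (2 ℕ.+ h))) (zeroʳ _)) (sumTo-cong (2 ℕ.+ h) shift) ⟩
    0# + sumTo (2 ℕ.+ h) (λ k → - t * (weight (q * q * t) k * fibCoeff h k))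
      ≈⟨ +-identityˡ _ ⟩
    sumTo (2 ℕ.+ h) (λ k → - t * (weight (q * q * t) k * fibCoeff h k))
      ≈⟨ sumTo-*ˡ (2 ℕ.+ h) (- t) _ ⟩
    - t * sumTo (2 ℕ.+ h) (λ k → weight (q * q * t) k * fibCoeff h k)
      ≈⟨ *-congˡ (fib-extend (q * q * t) h) ⟩
    - t * fib (q * q * t) h
      ∎
    where
    shift : ∀ k → weight t (suc k) * shiftedCoeff (2 ℕ.+ h) (suc k) ≈ - t * (weight (q * q * t) k * fibCoeff h k)
    shift k = trans (*-cong (weight-suc t k) (shiftedCoeff-suc-suc h k)) (*-assoc _ _ _)

  shiftedFib-rec : ∀ t h →
    shiftedFib t (3 ℕ.+ h) ≈ shiftedFib t (2 ℕ.+ h) - t * pow q (suc h) * shiftedFib t (suc h)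
  shiftedFib-rec t zero = begin
    shiftedFib t 3
      ≈⟨ trans (shiftedFib-suc-suc t 1) (*-congˡ (fib-one (q * q * t))) ⟩
    - t * 1#
      ≈⟨ solve 2 (λ t p → :- t :* con 1ℤ := :- t :* con 1ℤ :- t :* p :* con 0ℤ) refl t (pow q 1) ⟩
    - t * 1# - t * pow q 1 * 0#
      ≈⟨ +-cong (trans (shiftedFib-suc-suc t 0) (*-congˡ (fib-zero (q * q * t))))
                (-‿cong (*-congˡ (shiftedFib-one t))) ⟨
    shiftedFib t 2 - t * pow q 1 * shiftedFib t 1
      ∎
  shiftedFib-rec t (suc h) = begin
    shiftedFib t (4 ℕ.+ h)
      ≈⟨ shiftedFib-suc-suc t (2 ℕ.+ h) ⟩
    - t * fib t′ (2 ℕ.+ h)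
      ≈⟨ *-congˡ (fib-rec t′ h) ⟩
    - t * (fib t′ (suc h) - t′ * pow q h * fib t′ h)
      ≈⟨ solve 5 (λ t q p x y → :- t :* (x :- q :* q :* t :* p :* y)
                             := :- t :* x :- t :* (q :* (q :* p)) :* (:- t :* y))
                 refl t q (pow q h) _ _ ⟩
    - t * fib t′ (suc h) - t * pow q (2 ℕ.+ h) * (- t * fib t′ h)
      ≈⟨ +-cong (shiftedFib-suc-suc t (suc h)) (-‿cong (*-congˡ (shiftedFib-suc-suc t h))) ⟨
    shiftedFib t (3 ℕ.+ h) - t * pow q (2 ℕ.+ h) * shiftedFib t (2 ℕ.+ h)
      ∎
    where
    t′ = q * q * t

  -- The right-hand side of the theorem at b = 0.
  mixedFib : Carrier → Carrier → ℕ → Carrier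
  mixedFib a t h = fib t h - (1# - a) * shiftedFib t h

  mixedFib-one : ∀ a t → mixedFib a t 1 ≈ 1#
  mixedFib-one a t = begin
    fib t 1 - (1# - a) * shiftedFib t 1 ≈⟨ +-cong (fib-one t) (-‿cong (*-congˡ (shiftedFib-one t))) ⟩
    1# - (1# - a) * 0#                  ≈⟨ solve 1 (λ a → con 1ℤ :- (con 1ℤ :- a) :* con 0ℤ := con 1ℤ) refl a ⟩
    1#                                  ∎

  mixedFib-two : ∀ a t → mixedFib a t 2 ≈ 1# - a * t
  mixedFib-two a t = begin
    fib t 2 - (1# - a) * shiftedFib t 2
      ≈⟨ +-cong (fib-rec t 0) (-‿cong (*-congˡ (shiftedFib-suc-suc t 0))) ⟩
    (fib t 1 - t * 1# * fib t 0) - (1# - a) * (- t * fib (q * q * t) 0)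
      ≈⟨ +-cong (+-cong (fib-one t) (-‿cong (*-congˡ (fib-zero t))))
                (-‿cong (*-congˡ (*-congˡ (fib-zero (q * q * t))))) ⟩
    (1# - t * 1# * 1#) - (1# - a) * (- t * 1#)
      ≈⟨ solve 2 (λ a t → (con 1ℤ :- t :* con 1ℤ :* con 1ℤ) :- (con 1ℤ :- a) :* (:- t :* con 1ℤ)
                       := con 1ℤ :- a :* t) refl a t ⟩
    1# - a * t
      ∎

  mixedFib-rec : ∀ a t h →
    mixedFib a t (3 ℕ.+ h) ≈ mixedFib a t (2 ℕ.+ h) - t * pow q (suc h) * mixedFib a t (suc h)
  mixedFib-rec a t h = recurrence-combine (fib-rec t (suc h)) (shiftedFib-rec t h)
    where
    recurrence-combine : ∀ {x₃ x₂ x₁ y₃ y₂ y₁ s c} → x₃ ≈ x₂ - s * x₁ → y₃ ≈ y₂ - s * y₁ →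
      x₃ - c * y₃ ≈ (x₂ - c * y₂) - s * (x₁ - c * y₁)
    recurrence-combine {x₃} {x₂} {x₁} {y₃} {y₂} {y₁} {s} {c} x-rec y-rec = begin
      x₃ - c * y₃                        ≈⟨ +-cong x-rec (-‿cong (*-congˡ y-rec)) ⟩
      (x₂ - s * x₁) - c * (y₂ - s * y₁)
        ≈⟨ solve 6 (λ x₂ x₁ y₂ y₁ s c → (x₂ :- s :* x₁) :- c :* (y₂ :- s :* y₁)
                                     := (x₂ :- c :* y₂) :- s :* (x₁ :- c :* y₁))
                   refl x₂ x₁ y₂ y₁ s c ⟩
      (x₂ - c * y₂) - s * (x₁ - c * y₁)  ∎

  Q-from-recurrence : ∀ a t (F : ℕ → Carrier) → F 1 ≈ 1# → F 2 ≈ 1# - a * t →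
    (∀ h → F (3 ℕ.+ h) ≈ F (2 ℕ.+ h) - t * pow q (suc h) * F (suc h)) →
    ∀ b n → Q (suc n) a b q t ≈ (1# - b) * F (suc n) + b * F (2 ℕ.+ n)
  Q-from-recurrence a t F F₁ F₂ F-rec b zero = begin
    1# - a * b * t
      ≈⟨ solve 3 (λ a b t → con 1ℤ :- a :* b :* t := (con 1ℤ :- b) :* con 1ℤ :+ b :* (con 1ℤ :- a :* t))
                 refl a b t ⟩
    (1# - b) * 1# + b * (1# - a * t)   ≈⟨ +-cong (*-congˡ F₁) (*-congˡ F₂) ⟨
    (1# - b) * F 1 + b * F 2           ∎
  Q-from-recurrence a t F F₁ F₂ F-rec b (suc zero) = begin
    (1# - a * t) - b * q * t
      ≈⟨ solve 4 (λ a b q t → (con 1ℤ :- a :* t) :- b :* q :* t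
                           := (con 1ℤ :- b) :* (con 1ℤ :- a :* t)
                              :+ b :* ((con 1ℤ :- a :* t) :- t :* (q :* con 1ℤ) :* con 1ℤ))
                 refl a b q t ⟩
    (1# - b) * (1# - a * t) + b * ((1# - a * t) - t * pow q 1 * 1#)
      ≈⟨ +-cong (*-congˡ F₂) (*-congˡ (trans (F-rec 0) (+-cong F₂ (-‿cong (*-congˡ F₁))))) ⟨
    (1# - b) * F 2 + b * F 3
      ∎
  Q-from-recurrence a t F F₁ F₂ F-rec b (suc (suc n)) = begin
    Q (2 ℕ.+ n) a 1# q t - b * pow q (2 ℕ.+ n) * t * Q (suc n) a 1# q t
      ≈⟨ +-cong (Q-at-1 (suc n)) (-‿cong (*-congˡ (Q-at-1 n))) ⟩
    ((1# - 1#) * F (2 ℕ.+ n) + 1# * F (3 ℕ.+ n))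
      - b * pow q (2 ℕ.+ n) * t * ((1# - 1#) * F (suc n) + 1# * F (2 ℕ.+ n))
      ≈⟨ solve 6 (λ x₁ x₂ x₃ b p t →
                    ((con 1ℤ :- con 1ℤ) :* x₂ :+ con 1ℤ :* x₃)
                    :- b :* p :* t :* ((con 1ℤ :- con 1ℤ) :* x₁ :+ con 1ℤ :* x₂)
                 := (con 1ℤ :- b) :* x₃ :+ b :* (x₃ :- t :* p :* x₂))
                 refl (F (suc n)) (F (2 ℕ.+ n)) (F (3 ℕ.+ n)) b (pow q (2 ℕ.+ n)) t ⟩
    (1# - b) * F (3 ℕ.+ n) + b * (F (3 ℕ.+ n) - t * pow q (2 ℕ.+ n) * F (2 ℕ.+ n))
      ≈⟨ +-congˡ (*-congˡ (F-rec (suc n))) ⟨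
    (1# - b) * F (3 ℕ.+ n) + b * F (4 ℕ.+ n)
      ∎
    where
    Q-at-1 = Q-from-recurrence a t F F₁ F₂ F-rec 1#

  module _ (a b t : Carrier) where
    private
      fibSummand shiftedSummand : ℕ → ℕ → Carrier
      fibSummand h m = weight t m * fibCoeff h m
      shiftedSummand h m = weight t m * shiftedCoeff h m

    term-split : ∀ h m → term h a b q t m
      ≈ ((1# - b) * fibSummand h m + b * fibSummand (suc h) m)
        - (1# - a) * ((1# - b) * shiftedSummand h m + b * shiftedSummand (suc h) m)
    term-split h m = begin
      term h a b q t m
        ≈⟨ *-congˡ (+-congʳ (+-congʳ (+-cong (*-congˡ (qbin≈fibCoeff h m))
                                             (*-congˡ (qbin≈fibCoeff (suc h) m))))) ⟩
      weight t m * ((((1# - b) * fibCoeff h m + b * fibCoeff (suc h) m) - (1# - a) * (1# - b) * shiftedCoeff h m)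
                    - (1# - a) * b * shiftedCoeff (suc h) m)
        ≈⟨ solve 7 (λ a b w x₀ x₁ y₀ y₁ →
               w :* ((((con 1ℤ :- b) :* x₀ :+ b :* x₁) :- (con 1ℤ :- a) :* (con 1ℤ :- b) :* y₀)
                     :- (con 1ℤ :- a) :* b :* y₁)
            := ((con 1ℤ :- b) :* (w :* x₀) :+ b :* (w :* x₁))
               :- (con 1ℤ :- a) :* ((con 1ℤ :- b) :* (w :* y₀) :+ b :* (w :* y₁)))
            refl a b (weight t m) _ _ _ _ ⟩
      ((1# - b) * fibSummand h m + b * fibSummand (suc h) m)
        - (1# - a) * ((1# - b) * shiftedSummand h m + b * shiftedSummand (suc h) m)
        ∎

    RHS-split : ∀ h → RHS h a b q t ≈ (1# - b) * mixedFib a t h + b * mixedFib a t (suc h)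
    RHS-split h = begin
      sumTo (2 ℕ.+ h) (term h a b q t)
        ≈⟨ sumTo-cong (2 ℕ.+ h) (term-split h) ⟩
      sumTo (2 ℕ.+ h) (λ m → ((1# - b) * fibSummand h m + b * fibSummand (suc h) m)
                             - (1# - a) * ((1# - b) * shiftedSummand h m + b * shiftedSummand (suc h) m))
        ≈⟨ trans (sumTo-sub (2 ℕ.+ h) _ _) (+-congˡ (-‿cong (sumTo-*ˡ (2 ℕ.+ h) (1# - a) _))) ⟩
      sumTo (2 ℕ.+ h) (λ m → (1# - b) * fibSummand h m + b * fibSummand (suc h) m)
        - (1# - a) * sumTo (2 ℕ.+ h) (λ m → (1# - b) * shiftedSummand h m + b * shiftedSummand (suc h) m)
        ≈⟨ +-cong (sumTo-linear (2 ℕ.+ h) (1# - b) b _ _)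
                  (-‿cong (*-congˡ (sumTo-linear (2 ℕ.+ h) (1# - b) b _ _))) ⟩
      ((1# - b) * sumTo (2 ℕ.+ h) (fibSummand h) + b * fib t (suc h))
        - (1# - a) * ((1# - b) * sumTo (2 ℕ.+ h) (shiftedSummand h) + b * shiftedFib t (suc h))
        ≈⟨ +-cong (+-congʳ (*-congˡ (fib-extend t h)))
                  (-‿cong (*-congˡ (+-congʳ (*-congˡ (shiftedFib-extend t h))))) ⟩
      ((1# - b) * fib t h + b * fib t (suc h)) - (1# - a) * ((1# - b) * shiftedFib t h + b * shiftedFib t (suc h))
        ≈⟨ solve 6 (λ a b x₀ x₁ y₀ y₁ →
               ((con 1ℤ :- b) :* x₀ :+ b :* x₁) :- (con 1ℤ :- a) :* ((con 1ℤ :- b) :* y₀ :+ b :* y₁)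
            := (con 1ℤ :- b) :* (x₀ :- (con 1ℤ :- a) :* y₀) :+ b :* (x₁ :- (con 1ℤ :- a) :* y₁))
            refl a b _ _ _ _ ⟩
      (1# - b) * mixedFib a t h + b * mixedFib a t (suc h)
        ∎

proposition6 : ∀ {c ℓ} (R : CommutativeRing c ℓ) (h : ℕ) → 1 ≤ h →
    (a b q t : CommutativeRing.Carrier R) →
    CommutativeRing._≈_ R (QDefs.Q R h a b q t) (QDefs.RHS R h a b q t)
proposition6 R (suc n) _ a b q t = begin
  Q (suc n) a b q t
    ≈⟨ Q-from-recurrence a t (mixedFib a t) (mixedFib-one a t) (mixedFib-two a t) (mixedFib-rec a t) b n ⟩
  (1# - b) * mixedFib a t (suc n) + b * mixedFib a t (2 ℕ.+ n)
    ≈⟨ RHS-split a b t (suc n) ⟨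
  RHS (suc n) a b q t
    ∎
  where
  open CommutativeRing R
  open QDefs R
  open QFibonacci R q
  open import Relation.Binary.Reasoning.Setoid setoid
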